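{- Let $L = (a_0, a_1, \ldots, a_n)$ be a \textsc{Rotisserie Nim} position with $L \in \mathcal{P}$, and let $L' = (b_0, b_1, \ldots, b_n)$ be a list of positive integers of the same length such that $b_i \leq a_i$ for every even index $i$ and $b_i \geq a_i$ for every odd index $i$. Then $L' \in \mathcal{P}$.
   Context: \textsc{Rotisserie Nim} is an impartial combinatorial game played under normal play (a player unable to move loses). A position is a finite list $L = (a_0, a_1, \ldots, a_n)$ of positive integers (a queue of heaps, $a_0$ at the front); the empty list is terminal. The options of $L$ are $(a_1, \ldots, a_n)$ and $(a_1, \ldots, a_n, b)$ for every integer $b$ with $1 \leq b < a_0$. $\mathcal{N}$ denotes the positions from which the next player to move wins, $\mathcal{P}$ those from which the previous player wins. -}

module Defs where

open import Data.Nat using (ℕ; _≤_; _<_)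
open import Data.List using (List; []; _∷_; _++_; [_])

Positive : ℕ → Set
Positive a = 1 ≤ a

data Option : List ℕ → List ℕ → Set where
  remove : ∀ {a} {rest : List ℕ} → Option (a ∷ rest) rest
  rotate : ∀ {a b} {rest : List ℕ} → 1 ≤ b → b < a → Option (a ∷ rest) (rest ++ [ b ])

-- Outcome classes under normal play, defined inductively
-- (the game is well-founded, so these are the usual P/N classes).
data InP (L : List ℕ) : Set
data InN (L : List ℕ) : Set

data InP L where
  allOptionsN : (∀ L' → Option L L' → InN L') → InP L

data InN L where
  someOptionP : ∀ L' → Option L L' → InP L' → InN L

-- Call M ⊴ M' when M is pointwise below M' at even positions and above it at
-- odd positions.  Every move of M (drop the front heap, or rotate it to some
-- c below it) is also a move of M', since M's front heap is no larger, and the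
-- two resulting positions are related by ⊴ with the roles of M and M' swapped
-- (appending the same c to both keeps them related).  Hence by simultaneous
-- induction 𝒫 is downward closed and 𝒩 upward closed for ⊴.
module Submission where

open import Defs
open import Data.Nat using (ℕ; zero; suc; _≤_; _%_)
open import Data.Nat.Properties using (≤-refl; <-≤-trans)
open import Data.Fin using (Fin; toℕ) renaming (zero to fzero; suc to fsuc)
open import Data.List using (List; []; _∷_; _++_; [_])
open import Data.Vec using (Vec; lookup; toList) renaming ([] to []ᵥ; _∷_ to _∷ᵥ_)
open import Relation.Binary.PropositionalEquality using (_≡_; refl)

infix 4 _⊴_

data _⊴_ : List ℕ → List ℕ → Set where
  []  : [] ⊴ []
  _∷_ : ∀ {x y xs ys} → x ≤ y → ys ⊴ xs → x ∷ xs ⊴ y ∷ ys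

⊴-snoc : ∀ {xs ys} c → xs ⊴ ys → xs ++ [ c ] ⊴ ys ++ [ c ]
⊴-snoc c []            = ≤-refl ∷ []
⊴-snoc c (x≤y ∷ ys⊴xs) = x≤y ∷ ⊴-snoc c ys⊴xs

InP-⊴-downward : ∀ {M M'} → InP M' → M ⊴ M' → InP M
InN-⊴-upward   : ∀ {M M'} → InN M → M ⊴ M' → InN M'

InP-⊴-downward _ [] = allOptionsN λ _ ()
InP-⊴-downward (allOptionsN optionsN) (x≤y ∷ ys⊴xs) = allOptionsN λ where
  _ remove →
    InN-⊴-upward (optionsN _ remove) ys⊴xs
  _ (rotate {b = c} 1≤c c<x) →
    InN-⊴-upward (optionsN _ (rotate 1≤c (<-≤-trans c<x x≤y))) (⊴-snoc c ys⊴xs)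

InN-⊴-upward (someOptionP _ remove p) (x≤y ∷ ys⊴xs) =
  someOptionP _ remove (InP-⊴-downward p ys⊴xs)
InN-⊴-upward (someOptionP _ (rotate {b = c} 1≤c c<x) p) (x≤y ∷ ys⊴xs) =
  someOptionP _ (rotate 1≤c (<-≤-trans c<x x≤y)) (InP-⊴-downward p (⊴-snoc c ys⊴xs))

even⇒suc-odd : ∀ n → n % 2 ≡ 0 → suc n % 2 ≡ 1
even⇒suc-odd zero          _ = refl
even⇒suc-odd (suc zero)    ()
even⇒suc-odd (suc (suc n)) e = even⇒suc-odd n e

odd⇒suc-even : ∀ n → n % 2 ≡ 1 → suc n % 2 ≡ 0
odd⇒suc-even zero          ()
odd⇒suc-even (suc zero)    _ = refl
odd⇒suc-even (suc (suc n)) o = odd⇒suc-even n o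

toList-⊴ : ∀ {k} (xs ys : Vec ℕ k) →
  (∀ (i : Fin k) → toℕ i % 2 ≡ 0 → lookup xs i ≤ lookup ys i) →
  (∀ (i : Fin k) → toℕ i % 2 ≡ 1 → lookup ys i ≤ lookup xs i) →
  toList xs ⊴ toList ys
toList-⊴ []ᵥ []ᵥ _ _ = []
toList-⊴ (x ∷ᵥ xs) (y ∷ᵥ ys) even≤ odd≥ =
  even≤ fzero refl ∷ toList-⊴ ys xs
    (λ i e → odd≥ (fsuc i) (even⇒suc-odd (toℕ i) e))
    (λ i o → even≤ (fsuc i) (odd⇒suc-even (toℕ i) o))

mainTheorem8 : (n : ℕ) (L L' : Vec ℕ (suc n)) →
    (∀ i → Positive (lookup L i)) →
    (∀ i → Positive (lookup L' i)) →
    InP (toList L) →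
    (∀ (i : Fin (suc n)) → toℕ i % 2 ≡ 0 → lookup L' i ≤ lookup L i) →
    (∀ (i : Fin (suc n)) → toℕ i % 2 ≡ 1 → lookup L i ≤ lookup L' i) →
    InP (toList L')
mainTheorem8 n L L' _ _ L∈P even≤ odd≥ = InP-⊴-downward L∈P (toList-⊴ L' L even≤ odd≥)
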